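{- Let $\mathsf{T}=(t_{n,k})_{n,k\ge0}$ with $t_{n,k}=\binom nk n^{n-k}$ (with $0^0=1$). Then the production matrix $P=\mathsf{T}^{ -1}\Delta\mathsf{T}$ is the unit-lower-Hessenberg matrix $$P=B_1\,\Delta\,D\,T_1\,D^{ -1}.$$ More generally, for an indeterminate $\xi$, $B_\xi^{ -1}PB_\xi=B_1(\Delta+\xi I)\,D\,T_1\,D^{ -1}$.
   Context: $\Delta=(\delta_{i+1,j})_{i,j\ge0}$ is the matrix with $1$ on the superdiagonal and $0$ elsewhere; $I$ is the identity; $B_x$ is the matrix with entries $(B_x)_{ij}=\binom{i}{j}x^{i-j}$ (so $B_1$ is the binomial matrix); $T_1$ is the lower-triangular matrix with all entries on and below the diagonal equal to $1$; $D=\mathrm{diag}((n!)_{n\ge0})$. All matrices are indexed by $\mathbb{N}\times\mathbb{N}$ and computations are over $\mathbb{Q}[\xi]$. -}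

module Defs where

open import Data.Nat as ℕ using (ℕ; zero; suc; _∸_; _≤?_; _<_; _!)
open import Data.Nat.Properties using (_!≢0)
open import Data.Nat.Combinatorics using (_C_)
open import Data.Integer using (+_)
open import Data.Rational as ℚ using (ℚ; 0ℚ; 1ℚ)
open import Data.List using (List; []; _∷_; map)
open import Relation.Binary.PropositionalEquality using (_≡_)
open import Relation.Nullary using (does)
open import Data.Bool using (if_then_else_)

-- The polynomial ring ℚ[ξ]: coefficient lists (constant term first),
-- compared coefficientwise (so trailing zeros are irrelevant).

Poly : Set
Poly = List ℚ

coeff : Poly → ℕ → ℚ
coeff []       _       = 0ℚ
coeff (a ∷ p)  zero    = a
coeff (a ∷ p)  (suc n) = coeff p n

infix 4 _≈P_
_≈P_ : Poly → Poly → Set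
p ≈P q = ∀ n → coeff p n ≡ coeff q n

infixl 6 _+P_
_+P_ : Poly → Poly → Poly
[]      +P q       = q
(a ∷ p) +P []      = a ∷ p
(a ∷ p) +P (b ∷ q) = (a ℚ.+ b) ∷ (p +P q)

infixl 7 _*P_
_*P_ : Poly → Poly → Poly
[]      *P q = []
(a ∷ p) *P q = map (a ℚ.*_) q +P (0ℚ ∷ (p *P q))

const : ℚ → Poly
const a = a ∷ []

0P 1P : Poly
0P = []
1P = const 1ℚ

ξ : Poly
ξ = 0ℚ ∷ 1ℚ ∷ []

nat : ℕ → Poly
nat n = const (+ n ℚ./ 1)

infixr 8 _^P_
_^P_ : Poly → ℕ → Poly
p ^P zero  = 1P
p ^P suc n = p *P (p ^P n)

Mat : Set
Mat = ℕ → ℕ → Poly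

infix 4 _≈M_
_≈M_ : Mat → Mat → Set
A ≈M B = ∀ i j → A i j ≈P B i j

sumP : ℕ → (ℕ → Poly) → Poly
sumP zero    f = 0P
sumP (suc n) f = sumP n f +P f n

-- The entry (A·B)_{ij} = Σ_k A_{ik} B_{kj} is summed over
-- k ≤ i+1; this is the full (finite) sum whenever the left factor A is
-- lower Hessenberg (A_{ik} = 0 for k > i+1).  In the statement every left
-- factor is lower triangular or lower Hessenberg.
infixl 7 _·_
_·_ : Mat → Mat → Mat
(A · B) i j = sumP (suc (suc i)) (λ k → A i k *P B k j)

infixl 6 _⊕_
_⊕_ : Mat → Mat → Mat
(A ⊕ B) i j = A i j +P B i j

_⊙_ : Poly → Mat → Mat
(c ⊙ A) i j = c *P A i j

LowerTriangular : Mat → Set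
LowerTriangular A = ∀ i j → i < j → A i j ≈P 0P

I : Mat
I i j = if does (i ℕ.≟ j) then 1P else 0P

Δ : Mat
Δ i j = if does (suc i ℕ.≟ j) then 1P else 0P

B : Poly → Mat
B x i j = if does (j ≤? i) then nat (i C j) *P (x ^P (i ∸ j)) else 0P

T₁ : Mat
T₁ i j = if does (j ≤? i) then 1P else 0P

D : Mat
D i j = if does (i ℕ.≟ j) then nat (i !) else 0P

D⁻¹ : Mat
D⁻¹ i j = if does (i ℕ.≟ j) then const (oneOver (i !) {{i !≢0}}) else 0P
  where
  oneOver : (m : ℕ) → .{{_ : ℕ.NonZero m}} → ℚ
  oneOver m = + 1 ℚ./ m

𝖳 : Mat
𝖳 n k = if does (k ≤? n) then nat ((n C k) ℕ.* (n ℕ.^ (n ∸ k))) else 0P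

-- Write M = D T₁ D⁻¹ = (i!/k!) and U = 𝖳 B₁. Since B_x B_y = B_{x+y} and row n of 𝖳 is
-- row n of B_n, row n of U is row n of B_{n+1}. The claim Δ𝖳 = 𝖳 P with P = B₁ Δ M then
-- becomes (UΔ) M = Δ𝖳: both sides vanish above the superdiagonal and satisfy the column
-- recurrence X_{n,j} = (j+1) X_{n,j+1} + (UΔ)_{n,j} (for M this is i!/j! = (j+1) i!/(j+1)!,
-- for 𝖳 it is Pascal's rule together with (j+1) C(n+1,j+1) = (n+1) C(n,j)), so they agree.
-- For the ξ-version, M commutes with every B_x (M B_x and B_x M satisfy the same row
-- recurrence), Δ B_x = B_x (Δ + xI) and B₁ B_ξ = B_ξ B₁, whence P B_ξ = B_ξ B₁ (Δ + ξI) M.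

module Submission where

open import Algebra.Bundles using (CommutativeMonoid; CommutativeSemiring)
import Algebra.Properties.CommutativeSemigroup as CommutativeSemigroupProperties
import Algebra.Solver.Ring.NaturalCoefficients.Default as NaturalCoefficientsSolver
open import Algebra.Structures.Biased using (IsCommutativeMonoidˡ; IsCommutativeSemiringˡ)
open import Data.Bool using (if_then_else_)
open import Data.Empty using (⊥-elim)
open import Data.Integer as ℤ using (+_)
import Data.Integer.Properties as ℤₚ
open import Data.List using ([]; _∷_; map)
open import Data.Nat as ℕ using (ℕ; zero; suc; _≤_; _<_; z≤n; s≤s; _!; _∸_)
open import Data.Nat.Combinatorics using (nCk+nC[k+1]≡[n+1]C[k+1]; k>n⇒nCk≡0; nC1≡n)
  renaming (_C_ to _choose_)
import Data.Nat.Properties as ℕₚ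
import Data.Nat.Solver as ℕ-Solver
open import Data.Product using (_×_; _,_)
open import Data.Rational as ℚ using (ℚ; 0ℚ; 1ℚ)
import Data.Rational.Properties as ℚₚ
open import Data.Rational.Unnormalised as ℚᵘ using (mkℚᵘ; *≡*)
import Data.Rational.Unnormalised.Properties as ℚᵘₚ
open import Data.Sum using (_⊎_; inj₁; inj₂)
open import Function using (_∘_)
open import Relation.Binary.Bundles using (Setoid)
open import Relation.Binary.PropositionalEquality as ≡ using (_≡_; _≢_; refl; cong; cong₂)
import Relation.Binary.Reasoning.Setoid as SetoidReasoning
open import Relation.Binary.Structures using (IsEquivalence)
open import Relation.Nullary using (¬_; Dec; yes; no; does)

open import Defs

-- The polynomial ring ℚ[ξ] as a commutative semiring

-- A record rather than _≈P_ itself, so that both polynomials stay visible to unification.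
infix 4 _≋_
record _≋_ (p q : Poly) : Set where
  constructor coeffwise
  field ≋⇒≈P : p ≈P q

open _≋_ public

≋-isEquivalence : IsEquivalence _≋_
≋-isEquivalence = record
  { refl  = coeffwise λ _ → refl
  ; sym   = λ { (coeffwise e) → coeffwise λ n → ≡.sym (e n) }
  ; trans = λ { (coeffwise e) (coeffwise f) → coeffwise λ n → ≡.trans (e n) (f n) }
  }

open IsEquivalence ≋-isEquivalence public
  using () renaming (refl to ≋-refl; sym to ≋-sym; trans to ≋-trans)

≡⇒≋ : ∀ {p q} → p ≡ q → p ≋ q
≡⇒≋ refl = ≋-refl

scale : ℚ → Poly → Poly
scale a = map (a ℚ.*_)

coeff-+ : ∀ p q n → coeff (p +P q) n ≡ coeff p n ℚ.+ coeff q n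
coeff-+ []      q       n       = ≡.sym (ℚₚ.+-identityˡ _)
coeff-+ (a ∷ p) []      n       = ≡.sym (ℚₚ.+-identityʳ _)
coeff-+ (a ∷ p) (b ∷ q) zero    = refl
coeff-+ (a ∷ p) (b ∷ q) (suc n) = coeff-+ p q n

coeff-scale : ∀ a q n → coeff (scale a q) n ≡ a ℚ.* coeff q n
coeff-scale a []      n       = ≡.sym (ℚₚ.*-zeroʳ a)
coeff-scale a (b ∷ q) zero    = refl
coeff-scale a (b ∷ q) (suc n) = coeff-scale a q n

∷-cong : ∀ a {p q} → p ≋ q → a ∷ p ≋ a ∷ q
∷-cong a (coeffwise e) = coeffwise λ { zero → refl ; (suc n) → e n }

0∷0≋0 : 0ℚ ∷ 0P ≋ 0P
0∷0≋0 = coeffwise λ { zero → refl ; (suc n) → refl }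

+-cong : ∀ {p p′ q q′} → p ≋ p′ → q ≋ q′ → p +P q ≋ p′ +P q′
+-cong {p} {p′} {q} {q′} (coeffwise e) (coeffwise f) = coeffwise λ n → begin
  coeff (p +P q) n             ≡⟨ coeff-+ p q n ⟩
  coeff p n ℚ.+ coeff q n      ≡⟨ cong₂ ℚ._+_ (e n) (f n) ⟩
  coeff p′ n ℚ.+ coeff q′ n    ≡⟨ coeff-+ p′ q′ n ⟨
  coeff (p′ +P q′) n           ∎
  where open ≡.≡-Reasoning

+-comm : ∀ p q → p +P q ≋ q +P p
+-comm p q = coeffwise λ n → begin
  coeff (p +P q) n          ≡⟨ coeff-+ p q n ⟩
  coeff p n ℚ.+ coeff q n   ≡⟨ ℚₚ.+-comm (coeff p n) (coeff q n) ⟩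
  coeff q n ℚ.+ coeff p n   ≡⟨ coeff-+ q p n ⟨
  coeff (q +P p) n          ∎
  where open ≡.≡-Reasoning

+-assoc : ∀ p q r → (p +P q) +P r ≋ p +P (q +P r)
+-assoc p q r = coeffwise λ n → begin
  coeff ((p +P q) +P r) n                   ≡⟨ coeff-+ (p +P q) r n ⟩
  coeff (p +P q) n ℚ.+ coeff r n            ≡⟨ cong (ℚ._+ coeff r n) (coeff-+ p q n) ⟩
  (coeff p n ℚ.+ coeff q n) ℚ.+ coeff r n   ≡⟨ ℚₚ.+-assoc (coeff p n) (coeff q n) (coeff r n) ⟩
  coeff p n ℚ.+ (coeff q n ℚ.+ coeff r n)   ≡⟨ cong (coeff p n ℚ.+_) (coeff-+ q r n) ⟨
  coeff p n ℚ.+ coeff (q +P r) n            ≡⟨ coeff-+ p (q +P r) n ⟨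
  coeff (p +P (q +P r)) n                   ∎
  where open ≡.≡-Reasoning

+-commutativeMonoid : CommutativeMonoid _ _
+-commutativeMonoid = record
  { _≈_ = _≋_ ; _∙_ = _+P_ ; ε = 0P
  ; isCommutativeMonoid = IsCommutativeMonoidˡ.isCommutativeMonoid record
    { isSemigroup = record
      { isMagma = record { isEquivalence = ≋-isEquivalence ; ∙-cong = +-cong }
      ; assoc   = +-assoc
      }
    ; identityˡ = λ _ → ≋-refl
    ; comm      = +-comm
    }
  }

open CommutativeMonoid +-commutativeMonoid public
  using () renaming (identityʳ to +-identityʳ; ∙-congˡ to +-congˡ; ∙-congʳ to +-congʳ)

open CommutativeSemigroupProperties (CommutativeMonoid.commutativeSemigroup +-commutativeMonoid)
  using () renaming (interchange to +-interchange)

0∷-+ : ∀ p q → 0ℚ ∷ (p +P q) ≋ (0ℚ ∷ p) +P (0ℚ ∷ q)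
0∷-+ p q = coeffwise λ { zero → ≡.sym (ℚₚ.+-identityˡ 0ℚ) ; (suc n) → refl }

∷≋const+0∷ : ∀ a p → a ∷ p ≋ const a +P (0ℚ ∷ p)
∷≋const+0∷ a p = coeffwise λ { zero → ≡.sym (ℚₚ.+-identityʳ a) ; (suc n) → refl }

scale-congʳ : ∀ a {p q} → p ≋ q → scale a p ≋ scale a q
scale-congʳ a {p} {q} (coeffwise e) = coeffwise λ n →
  ≡.trans (coeff-scale a p n) (≡.trans (cong (a ℚ.*_) (e n)) (≡.sym (coeff-scale a q n)))

scale-+ : ∀ a p q → scale a (p +P q) ≋ scale a p +P scale a q
scale-+ a p q = coeffwise λ n → begin
  coeff (scale a (p +P q)) n                         ≡⟨ coeff-scale a (p +P q) n ⟩
  a ℚ.* coeff (p +P q) n                             ≡⟨ cong (a ℚ.*_) (coeff-+ p q n) ⟩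
  a ℚ.* (coeff p n ℚ.+ coeff q n)                    ≡⟨ ℚₚ.*-distribˡ-+ a (coeff p n) (coeff q n) ⟩
  a ℚ.* coeff p n ℚ.+ a ℚ.* coeff q n                ≡⟨ cong₂ ℚ._+_ (coeff-scale a p n) (coeff-scale a q n) ⟨
  coeff (scale a p) n ℚ.+ coeff (scale a q) n        ≡⟨ coeff-+ (scale a p) (scale a q) n ⟨
  coeff (scale a p +P scale a q) n                   ∎
  where open ≡.≡-Reasoning

+-scale : ∀ a b p → scale (a ℚ.+ b) p ≋ scale a p +P scale b p
+-scale a b p = coeffwise λ n → begin
  coeff (scale (a ℚ.+ b) p) n                        ≡⟨ coeff-scale (a ℚ.+ b) p n ⟩
  (a ℚ.+ b) ℚ.* coeff p n                            ≡⟨ ℚₚ.*-distribʳ-+ (coeff p n) a b ⟩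
  a ℚ.* coeff p n ℚ.+ b ℚ.* coeff p n                ≡⟨ cong₂ ℚ._+_ (coeff-scale a p n) (coeff-scale b p n) ⟨
  coeff (scale a p) n ℚ.+ coeff (scale b p) n        ≡⟨ coeff-+ (scale a p) (scale b p) n ⟨
  coeff (scale a p +P scale b p) n                   ∎
  where open ≡.≡-Reasoning

scale-scale : ∀ a b p → scale a (scale b p) ≋ scale (a ℚ.* b) p
scale-scale a b p = coeffwise λ n → begin
  coeff (scale a (scale b p)) n     ≡⟨ coeff-scale a (scale b p) n ⟩
  a ℚ.* coeff (scale b p) n         ≡⟨ cong (a ℚ.*_) (coeff-scale b p n) ⟩
  a ℚ.* (b ℚ.* coeff p n)           ≡⟨ ℚₚ.*-assoc a b (coeff p n) ⟨
  (a ℚ.* b) ℚ.* coeff p n           ≡⟨ coeff-scale (a ℚ.* b) p n ⟨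
  coeff (scale (a ℚ.* b) p) n       ∎
  where open ≡.≡-Reasoning

scale-zero : ∀ p → scale 0ℚ p ≋ 0P
scale-zero p = coeffwise λ n → ≡.trans (coeff-scale 0ℚ p n) (ℚₚ.*-zeroˡ (coeff p n))

scale-one : ∀ p → scale 1ℚ p ≋ p
scale-one p = coeffwise λ n → ≡.trans (coeff-scale 1ℚ p n) (ℚₚ.*-identityˡ (coeff p n))

scale-0∷ : ∀ a p → scale a (0ℚ ∷ p) ≋ 0ℚ ∷ scale a p
scale-0∷ a p = coeffwise λ { zero → ℚₚ.*-zeroʳ a ; (suc n) → refl }

scale-*ˡ : ∀ a p q → scale a p *P q ≋ scale a (p *P q)
scale-*ˡ a []      q = ≋-refl
scale-*ˡ a (b ∷ p) q = begin
  scale (a ℚ.* b) q +P (0ℚ ∷ (scale a p *P q))     ≈⟨ +-cong (≋-sym (scale-scale a b q)) (∷-cong 0ℚ (scale-*ˡ a p q)) ⟩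
  scale a (scale b q) +P (0ℚ ∷ scale a (p *P q))    ≈⟨ +-congˡ (≋-sym (scale-0∷ a (p *P q))) ⟩
  scale a (scale b q) +P scale a (0ℚ ∷ (p *P q))    ≈⟨ scale-+ a (scale b q) (0ℚ ∷ (p *P q)) ⟨
  scale a (scale b q +P (0ℚ ∷ (p *P q)))            ∎
  where open SetoidReasoning (CommutativeMonoid.setoid +-commutativeMonoid)

≋0-* : ∀ {p} q → p ≋ 0P → p *P q ≋ 0P
≋0-* {[]}    q _             = ≋-refl
≋0-* {a ∷ p} q (coeffwise e) = begin
  scale a q +P (0ℚ ∷ (p *P q))   ≈⟨ +-cong (≡⇒≋ (cong (λ b → scale b q) (e 0))) (∷-cong 0ℚ (≋0-* {p} q (coeffwise (e ∘ suc)))) ⟩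
  scale 0ℚ q +P (0ℚ ∷ 0P)        ≈⟨ +-cong (scale-zero q) 0∷0≋0 ⟩
  0P                             ∎
  where open SetoidReasoning (CommutativeMonoid.setoid +-commutativeMonoid)

*-congʳ : ∀ {p p′} q → p ≋ p′ → p *P q ≋ p′ *P q
*-congʳ {[]}    {p′}      q e             = ≋-sym (≋0-* q (≋-sym e))
*-congʳ {a ∷ p} {[]}      q e             = ≋0-* q e
*-congʳ {a ∷ p} {a′ ∷ p′} q (coeffwise e) =
  +-cong (≡⇒≋ (cong (λ b → scale b q) (e 0))) (∷-cong 0ℚ (*-congʳ {p} {p′} q (coeffwise (e ∘ suc))))

*-congˡ : ∀ p {q q′} → q ≋ q′ → p *P q ≋ p *P q′
*-congˡ []      e = ≋-refl
*-congˡ (a ∷ p) e = +-cong (scale-congʳ a e) (∷-cong 0ℚ (*-congˡ p e))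

*-zeroʳ : ∀ p → p *P 0P ≋ 0P
*-zeroʳ []      = ≋-refl
*-zeroʳ (a ∷ p) = ≋-trans (∷-cong 0ℚ (*-zeroʳ p)) 0∷0≋0

≋0-*ʳ : ∀ p {q} → q ≋ 0P → p *P q ≋ 0P
≋0-*ʳ p q≋0 = ≋-trans (*-congˡ p q≋0) (*-zeroʳ p)

*-distribʳ-+ : ∀ q p p′ → (p +P p′) *P q ≋ p *P q +P p′ *P q
*-distribʳ-+ q []      p′       = ≋-refl
*-distribʳ-+ q (a ∷ p) []       = ≋-sym (+-identityʳ _)
*-distribʳ-+ q (a ∷ p) (b ∷ p′) = begin
  scale (a ℚ.+ b) q +P (0ℚ ∷ ((p +P p′) *P q))
    ≈⟨ +-cong (+-scale a b q) (≋-trans (∷-cong 0ℚ (*-distribʳ-+ q p p′)) (0∷-+ (p *P q) (p′ *P q))) ⟩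
  (scale a q +P scale b q) +P ((0ℚ ∷ (p *P q)) +P (0ℚ ∷ (p′ *P q)))
    ≈⟨ +-interchange (scale a q) (scale b q) (0ℚ ∷ (p *P q)) (0ℚ ∷ (p′ *P q)) ⟩
  (scale a q +P (0ℚ ∷ (p *P q))) +P (scale b q +P (0ℚ ∷ (p′ *P q)))
    ∎
  where open SetoidReasoning (CommutativeMonoid.setoid +-commutativeMonoid)

*-distribˡ-+ : ∀ p q q′ → p *P (q +P q′) ≋ p *P q +P p *P q′
*-distribˡ-+ []      q q′ = ≋-refl
*-distribˡ-+ (a ∷ p) q q′ = begin
  scale a (q +P q′) +P (0ℚ ∷ (p *P (q +P q′)))
    ≈⟨ +-cong (scale-+ a q q′) (≋-trans (∷-cong 0ℚ (*-distribˡ-+ p q q′)) (0∷-+ (p *P q) (p *P q′))) ⟩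
  (scale a q +P scale a q′) +P ((0ℚ ∷ (p *P q)) +P (0ℚ ∷ (p *P q′)))
    ≈⟨ +-interchange (scale a q) (scale a q′) (0ℚ ∷ (p *P q)) (0ℚ ∷ (p *P q′)) ⟩
  (scale a q +P (0ℚ ∷ (p *P q))) +P (scale a q′ +P (0ℚ ∷ (p *P q′)))
    ∎
  where open SetoidReasoning (CommutativeMonoid.setoid +-commutativeMonoid)

*-0∷ʳ : ∀ p q → p *P (0ℚ ∷ q) ≋ 0ℚ ∷ (p *P q)
*-0∷ʳ []      q = ≋-sym 0∷0≋0
*-0∷ʳ (a ∷ p) q = begin
  scale a (0ℚ ∷ q) +P (0ℚ ∷ (p *P (0ℚ ∷ q)))   ≈⟨ +-cong (scale-0∷ a q) (∷-cong 0ℚ (*-0∷ʳ p q)) ⟩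
  (0ℚ ∷ scale a q) +P (0ℚ ∷ (0ℚ ∷ (p *P q)))    ≈⟨ 0∷-+ (scale a q) (0ℚ ∷ (p *P q)) ⟨
  0ℚ ∷ (scale a q +P (0ℚ ∷ (p *P q)))           ∎
  where open SetoidReasoning (CommutativeMonoid.setoid +-commutativeMonoid)

0∷-*ˡ : ∀ p q → (0ℚ ∷ p) *P q ≋ 0ℚ ∷ (p *P q)
0∷-*ˡ p q = +-cong (scale-zero q) ≋-refl

*-constʳ : ∀ a q → q *P const a ≋ scale a q
*-constʳ a []      = ≋-refl
*-constʳ a (b ∷ q) = coeffwise λ
  { zero    → ≡.trans (ℚₚ.+-identityʳ (b ℚ.* a)) (ℚₚ.*-comm b a)
  ; (suc n) → ≋⇒≈P (*-constʳ a q) n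
  }

*-comm : ∀ p q → p *P q ≋ q *P p
*-comm []      q = ≋-sym (*-zeroʳ q)
*-comm (a ∷ p) q = begin
  scale a q +P (0ℚ ∷ (p *P q))   ≈⟨ +-cong (≋-sym (*-constʳ a q)) (≋-trans (∷-cong 0ℚ (*-comm p q)) (≋-sym (*-0∷ʳ q p))) ⟩
  q *P const a +P q *P (0ℚ ∷ p)  ≈⟨ *-distribˡ-+ q (const a) (0ℚ ∷ p) ⟨
  q *P (const a +P (0ℚ ∷ p))     ≈⟨ *-congˡ q (∷≋const+0∷ a p) ⟨
  q *P (a ∷ p)                   ∎
  where open SetoidReasoning (CommutativeMonoid.setoid +-commutativeMonoid)

*-assoc : ∀ p q r → (p *P q) *P r ≋ p *P (q *P r)
*-assoc []      q r = ≋-refl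
*-assoc (a ∷ p) q r = begin
  (scale a q +P (0ℚ ∷ (p *P q))) *P r           ≈⟨ *-distribʳ-+ r (scale a q) (0ℚ ∷ (p *P q)) ⟩
  scale a q *P r +P (0ℚ ∷ (p *P q)) *P r        ≈⟨ +-cong (scale-*ˡ a q r) (0∷-*ˡ (p *P q) r) ⟩
  scale a (q *P r) +P (0ℚ ∷ ((p *P q) *P r))    ≈⟨ +-congˡ (∷-cong 0ℚ (*-assoc p q r)) ⟩
  scale a (q *P r) +P (0ℚ ∷ (p *P (q *P r)))    ∎
  where open SetoidReasoning (CommutativeMonoid.setoid +-commutativeMonoid)

*-identityˡ : ∀ p → 1P *P p ≋ p
*-identityˡ p = ≋-trans (+-cong (scale-one p) 0∷0≋0) (+-identityʳ p)

Poly-commutativeSemiring : CommutativeSemiring _ _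
Poly-commutativeSemiring = record
  { _≈_ = _≋_ ; _+_ = _+P_ ; _*_ = _*P_ ; 0# = 0P ; 1# = 1P
  ; isCommutativeSemiring = IsCommutativeSemiringˡ.isCommutativeSemiring record
    { +-isCommutativeMonoid = CommutativeMonoid.isCommutativeMonoid +-commutativeMonoid
    ; *-isCommutativeMonoid = IsCommutativeMonoidˡ.isCommutativeMonoid record
      { isSemigroup = record
        { isMagma = record
          { isEquivalence = ≋-isEquivalence
          ; ∙-cong        = λ {p} {p′} {q} e f → ≋-trans (*-congʳ q e) (*-congˡ p′ f)
          }
        ; assoc   = *-assoc
        }
      ; identityˡ = *-identityˡ
      ; comm      = *-comm
      }
    ; distribʳ = *-distribʳ-+
    ; zeroˡ    = λ _ → ≋-refl
    }
  }

open CommutativeSemiring Poly-commutativeSemiring public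
  using (setoid; *-cong; *-identityʳ)

module PolySolver = NaturalCoefficientsSolver Poly-commutativeSemiring

toℚᵘ-/1 : ∀ n → ℚ.toℚᵘ (+ n ℚ./ 1) ℚᵘ.≃ mkℚᵘ (+ n) 0
toℚᵘ-/1 n = ℚₚ.toℚᵘ-fromℚᵘ (mkℚᵘ (+ n) 0)

/1-+ : ∀ m n → + (m ℕ.+ n) ℚ./ 1 ≡ + m ℚ./ 1 ℚ.+ + n ℚ./ 1
/1-+ m n = ℚₚ.toℚᵘ-injective (ℚᵘₚ.≃-trans (toℚᵘ-/1 (m ℕ.+ n)) (ℚᵘₚ.≃-trans sum
  (ℚᵘₚ.≃-sym (ℚᵘₚ.≃-trans (ℚₚ.toℚᵘ-homo-+ (+ m ℚ./ 1) (+ n ℚ./ 1)) (ℚᵘₚ.+-cong (toℚᵘ-/1 m) (toℚᵘ-/1 n))))))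
  where
  sum : mkℚᵘ (+ (m ℕ.+ n)) 0 ℚᵘ.≃ mkℚᵘ (+ m) 0 ℚᵘ.+ mkℚᵘ (+ n) 0
  sum = *≡* (cong (ℤ._* + 1) (≡.trans (ℤₚ.pos-+ m n)
    (≡.sym (cong₂ ℤ._+_ (ℤₚ.*-identityʳ (+ m)) (ℤₚ.*-identityʳ (+ n))))))

/1-* : ∀ m n → + (m ℕ.* n) ℚ./ 1 ≡ (+ m ℚ./ 1) ℚ.* (+ n ℚ./ 1)
/1-* m n = ℚₚ.toℚᵘ-injective (ℚᵘₚ.≃-trans (toℚᵘ-/1 (m ℕ.* n)) (ℚᵘₚ.≃-trans product
  (ℚᵘₚ.≃-sym (ℚᵘₚ.≃-trans (ℚₚ.toℚᵘ-homo-* (+ m ℚ./ 1) (+ n ℚ./ 1)) (ℚᵘₚ.*-cong (toℚᵘ-/1 m) (toℚᵘ-/1 n))))))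
  where
  product : mkℚᵘ (+ (m ℕ.* n)) 0 ℚᵘ.≃ mkℚᵘ (+ m) 0 ℚᵘ.* mkℚᵘ (+ n) 0
  product = *≡* (cong (ℤ._* + 1) (ℤₚ.pos-* m n))

/1-*-1/ : ∀ m n .{{_ : ℕ.NonZero n}} → (+ (m ℕ.* n) ℚ./ 1) ℚ.* (+ 1 ℚ./ n) ≡ + m ℚ./ 1
/1-*-1/ m n@(suc n-1) = ℚₚ.toℚᵘ-injective (ℚᵘₚ.≃-trans (ℚₚ.toℚᵘ-homo-* (+ (m ℕ.* n) ℚ./ 1) (+ 1 ℚ./ n))
  (ℚᵘₚ.≃-trans (ℚᵘₚ.*-cong (toℚᵘ-/1 (m ℕ.* n)) (ℚₚ.toℚᵘ-fromℚᵘ (mkℚᵘ (+ 1) n-1)))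
  (ℚᵘₚ.≃-trans cancel (ℚᵘₚ.≃-sym (toℚᵘ-/1 m)))))
  where
  cancel : mkℚᵘ (+ (m ℕ.* n)) 0 ℚᵘ.* mkℚᵘ (+ 1) n-1 ℚᵘ.≃ mkℚᵘ (+ m) 0
  cancel = *≡* (≡.trans (ℤₚ.*-identityʳ _) (≡.trans (ℤₚ.*-identityʳ _)
    (≡.trans (cong (λ k → + (m ℕ.* k)) (≡.sym (ℕₚ.*-identityˡ n))) (ℤₚ.pos-* m (1 ℕ.* n)))))

nat-0 : nat 0 ≋ 0P
nat-0 = coeffwise λ { zero → refl ; (suc n) → refl }

nat-+ : ∀ m n → nat (m ℕ.+ n) ≋ nat m +P nat n
nat-+ m n = coeffwise λ { zero → /1-+ m n ; (suc k) → refl }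

nat-* : ∀ m n → nat (m ℕ.* n) ≋ nat m *P nat n
nat-* m n = coeffwise λ
  { zero    → ≡.trans (/1-* m n) (≡.sym (ℚₚ.+-identityʳ _))
  ; (suc k) → refl
  }

nat-^ : ∀ m e → nat (m ℕ.^ e) ≋ nat m ^P e
nat-^ m zero    = ≋-refl
nat-^ m (suc e) = ≋-trans (nat-* m (m ℕ.^ e)) (*-congˡ (nat m) (nat-^ m e))

^P-congˡ : ∀ {x y} e → x ≋ y → x ^P e ≋ y ^P e
^P-congˡ zero    _   = ≋-refl
^P-congˡ (suc e) x≋y = *-cong x≋y (^P-congˡ e x≋y)

sumP-cong : ∀ n {f g : ℕ → Poly} → (∀ k → k < n → f k ≋ g k) → sumP n f ≋ sumP n g
sumP-cong zero    _   = ≋-refl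
sumP-cong (suc n) f≋g = +-cong (sumP-cong n λ k k<n → f≋g k (ℕₚ.m<n⇒m<1+n k<n)) (f≋g n ℕₚ.≤-refl)

sumP-+ : ∀ n (f g : ℕ → Poly) → sumP n (λ k → f k +P g k) ≋ sumP n f +P sumP n g
sumP-+ zero    f g = ≋-refl
sumP-+ (suc n) f g =
  ≋-trans (+-congʳ (sumP-+ n f g)) (+-interchange (sumP n f) (sumP n g) (f n) (g n))

*-distribˡ-sumP : ∀ n c (f : ℕ → Poly) → c *P sumP n f ≋ sumP n (λ k → c *P f k)
*-distribˡ-sumP zero    c f = *-zeroʳ c
*-distribˡ-sumP (suc n) c f =
  ≋-trans (*-distribˡ-+ c (sumP n f) (f n)) (+-congʳ (*-distribˡ-sumP n c f))

*-distribʳ-sumP : ∀ n c (f : ℕ → Poly) → sumP n f *P c ≋ sumP n (λ k → f k *P c)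
*-distribʳ-sumP n c f = ≋-trans (*-comm (sumP n f) c)
  (≋-trans (*-distribˡ-sumP n c f) (sumP-cong n λ k _ → *-comm c (f k)))

sumP-zero : ∀ n {f : ℕ → Poly} → (∀ k → k < n → f k ≋ 0P) → sumP n f ≋ 0P
sumP-zero n f≋0 = ≋-trans (sumP-cong n f≋0) (sumP-const-0 n)
  where
  sumP-const-0 : ∀ n → sumP n (λ _ → 0P) ≋ 0P
  sumP-const-0 zero    = ≋-refl
  sumP-const-0 (suc n) = ≋-trans (+-identityʳ _) (sumP-const-0 n)

sumP-vanishing-tail : ∀ {n m} {f : ℕ → Poly} → n ≤ m → (∀ k → n ≤ k → k < m → f k ≋ 0P) →
                      sumP m f ≋ sumP n f
sumP-vanishing-tail {m = zero}  z≤n _    = ≋-refl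
sumP-vanishing-tail {n} {suc m} {f} n≤1+m tail≋0 with ℕₚ.m≤n⇒m<n∨m≡n n≤1+m
... | inj₂ refl     = ≋-refl
... | inj₁ (s≤s n≤m) = ≋-trans
  (+-cong (sumP-vanishing-tail n≤m λ k n≤k k<m → tail≋0 k n≤k (ℕₚ.m<n⇒m<1+n k<m)) (tail≋0 m n≤m ℕₚ.≤-refl))
  (+-identityʳ (sumP n f))

sumP-suc : ∀ n (f : ℕ → Poly) → sumP (suc n) f ≋ f 0 +P sumP n (f ∘ suc)
sumP-suc zero    f = ≋-sym (+-identityʳ (f 0))
sumP-suc (suc n) f = ≋-trans (+-congʳ (sumP-suc n f)) (+-assoc (f 0) (sumP n (f ∘ suc)) (f (suc n)))

sumP-comm : ∀ n m (f : ℕ → ℕ → Poly) →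
            sumP n (λ l → sumP m (f l)) ≋ sumP m (λ k → sumP n (λ l → f l k))
sumP-comm zero    m f = ≋-sym (sumP-zero m λ _ _ → ≋-refl)
sumP-comm (suc n) m f = ≋-trans (+-congʳ (sumP-comm n m f))
  (≋-sym (sumP-+ m (λ k → sumP n (λ l → f l k)) (f n)))

sumP-single : ∀ n a {f : ℕ → Poly} → a < n → (∀ k → k < n → k ≢ a → f k ≋ 0P) → sumP n f ≋ f a
sumP-single (suc n) a {f} a<1+n others≋0 with n ℕ.≟ a
... | yes refl =
  +-congʳ (sumP-zero n λ k k<n → others≋0 k (ℕₚ.m<n⇒m<1+n k<n) λ { refl → ℕₚ.<-irrefl refl k<n })
... | no n≢a = ≋-trans
  (+-cong (sumP-single n a (ℕₚ.≤∧≢⇒< (ℕₚ.≤-pred a<1+n) (n≢a ∘ ≡.sym)) λ k k<n → others≋0 k (ℕₚ.m<n⇒m<1+n k<n))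
          (others≋0 n ℕₚ.≤-refl n≢a))
  (+-identityʳ (f a))

-- Matrices

if-yes : ∀ {P : Set} (d : Dec P) {x y : Poly} → P → (if does d then x else y) ≋ x
if-yes (yes _) _  = ≋-refl
if-yes (no ¬p) p = ⊥-elim (¬p p)

if-no : ∀ {P : Set} (d : Dec P) {x y : Poly} → ¬ P → (if does d then x else y) ≋ y
if-no (yes p) ¬p = ⊥-elim (¬p p)
if-no (no _)  _  = ≋-refl

infix 4 _≋M_
_≋M_ : Mat → Mat → Set
A ≋M C = ∀ i j → A i j ≋ C i j

≋M-setoid : Setoid _ _
≋M-setoid = record
  { Carrier       = Mat
  ; _≈_           = _≋M_
  ; isEquivalence = record
    { refl  = λ _ _ → ≋-refl
    ; sym   = λ e i j → ≋-sym (e i j)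
    ; trans = λ e f i j → ≋-trans (e i j) (f i j)
    }
  }

open Setoid ≋M-setoid public using () renaming (sym to ≋M-sym; trans to ≋M-trans)

≋M⇒≈M : ∀ {A C} → A ≋M C → A ≈M C
≋M⇒≈M e i j = ≋⇒≈P (e i j)

UpperBandwidth : ℕ → Mat → Set
UpperBandwidth b A = ∀ i j → b ℕ.+ i < j → A i j ≋ 0P

Lower Hessenberg : Mat → Set
Lower      = UpperBandwidth 0
Hessenberg = UpperBandwidth 1

UpperBandwidth-mono : ∀ {a b A} → a ≤ b → UpperBandwidth a A → UpperBandwidth b A
UpperBandwidth-mono a≤b band i j b+i<j = band i j (ℕₚ.≤-<-trans (ℕₚ.+-monoˡ-≤ i a≤b) b+i<j)

Lower⇒Hessenberg : ∀ {A} → Lower A → Hessenberg A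
Lower⇒Hessenberg = UpperBandwidth-mono z≤n

·-congˡ : ∀ A {C C′} → C ≋M C′ → A · C ≋M A · C′
·-congˡ A C≋C′ i j = sumP-cong (2 ℕ.+ i) λ k _ → *-congˡ (A i k) (C≋C′ k j)

·-congʳ : ∀ {A A′} C → A ≋M A′ → A · C ≋M A′ · C
·-congʳ C A≋A′ i j = sumP-cong (2 ℕ.+ i) λ k _ → *-congʳ (C k j) (A≋A′ i k)

·-cong : ∀ {A A′ C C′} → A ≋M A′ → C ≋M C′ → A · C ≋M A′ · C′
·-cong {A′ = A′} {C = C} A≋A′ C≋C′ = ≋M-trans (·-congʳ C A≋A′) (·-congˡ A′ C≋C′)

·-as-sumP : ∀ {A} C → Hessenberg A → ∀ i j {N} → 2 ℕ.+ i ≤ N →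
            (A · C) i j ≋ sumP N (λ k → A i k *P C k j)
·-as-sumP C hess i j 2+i≤N = ≋-sym (sumP-vanishing-tail 2+i≤N λ k 2+i≤k _ → ≋0-* (C k j) (hess i k 2+i≤k))

·-entry-zero : ∀ A C i j → (∀ k → A i k ≋ 0P ⊎ C k j ≋ 0P) → (A · C) i j ≋ 0P
·-entry-zero A C i j factor≋0 = sumP-zero (2 ℕ.+ i) λ k _ → term≋0 k (factor≋0 k)
  where
  term≋0 : ∀ k → A i k ≋ 0P ⊎ C k j ≋ 0P → A i k *P C k j ≋ 0P
  term≋0 k (inj₁ A≋0) = ≋0-* (C k j) A≋0
  term≋0 k (inj₂ C≋0) = ≋0-*ʳ (A i k) C≋0

UpperBandwidth-· : ∀ {a c A C} → UpperBandwidth a A → UpperBandwidth c C → UpperBandwidth (a ℕ.+ c) (A · C)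
UpperBandwidth-· {a} {c} {A} {C} bandA bandC i j a+c+i<j = ·-entry-zero A C i j factor≋0
  where
  factor≋0 : ∀ k → A i k ≋ 0P ⊎ C k j ≋ 0P
  factor≋0 k with a ℕ.+ i ℕ.<? k
  ... | yes a+i<k = inj₁ (bandA i k a+i<k)
  ... | no  a+i≮k = inj₂ (bandC k j (ℕₚ.≤-<-trans c+k≤a+c+i a+c+i<j))
    where
    c+k≤a+c+i : c ℕ.+ k ≤ a ℕ.+ c ℕ.+ i
    c+k≤a+c+i = ℕₚ.≤-trans (ℕₚ.+-monoʳ-≤ c (ℕₚ.≮⇒≥ a+i≮k))
      (ℕₚ.≤-reflexive (≡.trans (≡.sym (ℕₚ.+-assoc c a i)) (cong (ℕ._+ i) (ℕₚ.+-comm c a))))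

-- The product only sums over k ≤ i + 1, so associativity needs the corner terms k = i + 2
-- to vanish.
·-assoc : ∀ A C E → Hessenberg C → (∀ i l → l < 2 ℕ.+ i → A i l *P C l (2 ℕ.+ i) ≋ 0P) →
          A · (C · E) ≋M (A · C) · E
·-assoc A C E hessC corner≋0 i j = begin
  sumP N (λ l → A i l *P (C · E) l j)
    ≈⟨ sumP-cong N (λ l l<N → *-congˡ (A i l) (·-as-sumP E hessC l j (s≤s l<N))) ⟩
  sumP N (λ l → A i l *P sumP (suc N) (λ k → C l k *P E k j))
    ≈⟨ sumP-cong N (λ l _ → *-distribˡ-sumP (suc N) (A i l) (λ k → C l k *P E k j)) ⟩
  sumP N (λ l → sumP (suc N) (λ k → A i l *P (C l k *P E k j)))
    ≈⟨ sumP-cong N (λ l l<N → sumP-vanishing-tail (ℕₚ.n≤1+n N) (λ k N≤k k<1+N → corner l l<N k N≤k k<1+N)) ⟩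
  sumP N (λ l → sumP N (λ k → A i l *P (C l k *P E k j)))
    ≈⟨ sumP-comm N N (λ l k → A i l *P (C l k *P E k j)) ⟩
  sumP N (λ k → sumP N (λ l → A i l *P (C l k *P E k j)))
    ≈⟨ sumP-cong N (λ k _ → sumP-cong N λ l _ → ≋-sym (*-assoc (A i l) (C l k) (E k j))) ⟩
  sumP N (λ k → sumP N (λ l → (A i l *P C l k) *P E k j))
    ≈⟨ sumP-cong N (λ k _ → *-distribʳ-sumP N (E k j) (λ l → A i l *P C l k)) ⟨
  sumP N (λ k → (A · C) i k *P E k j)
    ∎
  where
  open SetoidReasoning setoid
  N = 2 ℕ.+ i
  corner : ∀ l → l < N → ∀ k → N ≤ k → k < suc N → A i l *P (C l k *P E k j) ≋ 0P
  corner l l<N k N≤k k<1+N with ℕₚ.≤-antisym N≤k (ℕₚ.≤-pred k<1+N)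
  ... | refl = ≋-trans (≋-sym (*-assoc (A i l) (C l k) (E k j))) (≋0-* (E k j) (corner≋0 i l l<N))

·-assoc-Lower-Hessenberg : ∀ {A C} E → Lower A → Hessenberg C → A · (C · E) ≋M (A · C) · E
·-assoc-Lower-Hessenberg {A} {C} E lowerA hessC = ·-assoc A C E hessC corner≋0
  where
  corner≋0 : ∀ i l → l < 2 ℕ.+ i → A i l *P C l (2 ℕ.+ i) ≋ 0P
  corner≋0 i l _ with i ℕ.<? l
  ... | yes i<l = ≋0-* (C l (2 ℕ.+ i)) (lowerA i l i<l)
  ... | no  i≮l = ≋0-*ʳ (A i l) (hessC l (2 ℕ.+ i) (s≤s (s≤s (ℕₚ.≮⇒≥ i≮l))))

·-assoc-Lower : ∀ A {C} E → Lower C → A · (C · E) ≋M (A · C) · E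
·-assoc-Lower A {C} E lowerC =
  ·-assoc A C E (Lower⇒Hessenberg lowerC) λ i l l<2+i → ≋0-*ʳ (A i l) (lowerC l (2 ℕ.+ i) l<2+i)

sparse-row-· : ∀ E A i c j → c < 2 ℕ.+ i → (∀ k → k ≢ c → E i k ≋ 0P) → (E · A) i j ≋ E i c *P A c j
sparse-row-· E A i c j c<2+i others≋0 =
  sumP-single (2 ℕ.+ i) c c<2+i λ k _ k≢c → ≋0-* (A k j) (others≋0 k k≢c)

·-sparse-column : ∀ {A} G → Hessenberg A → ∀ i r j → (∀ k → k ≢ r → G k j ≋ 0P) → (A · G) i j ≋ A i r *P G r j
·-sparse-column {A} G hessA i r j others≋0 with r ℕ.<? 2 ℕ.+ i
... | yes r<2+i = sumP-single (2 ℕ.+ i) r r<2+i λ k _ k≢r → ≋0-*ʳ (A i k) (others≋0 k k≢r)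
... | no  r≮2+i = ≋-trans
  (sumP-zero (2 ℕ.+ i) λ k k<2+i → ≋0-*ʳ (A i k) (others≋0 k λ { refl → r≮2+i k<2+i }))
  (≋-sym (≋0-* (G r j) (hessA i r (ℕₚ.≰⇒> (r≮2+i ∘ s≤s)))))

I-· : ∀ A → I · A ≋M A
I-· A i j = ≋-trans (sparse-row-· I A i i j (s≤s (ℕₚ.n≤1+n i)) λ k k≢i → if-no (i ℕ.≟ k) (k≢i ∘ ≡.sym))
  (≋-trans (*-congʳ (A i j) (if-yes (i ℕ.≟ i) refl)) (*-identityˡ (A i j)))

Δ-· : ∀ A → Δ · A ≋M λ i j → A (suc i) j
Δ-· A i j = ≋-trans (sparse-row-· Δ A i (suc i) j ℕₚ.≤-refl λ k k≢1+i → if-no (suc i ℕ.≟ k) (k≢1+i ∘ ≡.sym))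
  (≋-trans (*-congʳ (A (suc i) j) (if-yes (suc i ℕ.≟ suc i) refl)) (*-identityˡ (A (suc i) j)))

D-· : ∀ A → D · A ≋M λ i j → nat (i !) *P A i j
D-· A i j = ≋-trans (sparse-row-· D A i i j (s≤s (ℕₚ.n≤1+n i)) λ k k≢i → if-no (i ℕ.≟ k) (k≢i ∘ ≡.sym))
  (*-congʳ (A i j) (if-yes (i ℕ.≟ i) refl))

·-I : ∀ {A} → Hessenberg A → A · I ≋M A
·-I {A} hessA i j = ≋-trans (·-sparse-column I hessA i j j λ k k≢j → if-no (k ℕ.≟ j) k≢j)
  (≋-trans (*-congˡ (A i j) (if-yes (j ℕ.≟ j) refl)) (*-identityʳ (A i j)))

shiftRight : (ℕ → Poly) → ℕ → Poly
shiftRight r zero    = 0P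
shiftRight r (suc j) = r j

·-Δ : ∀ {A} → Hessenberg A → A · Δ ≋M λ i → shiftRight (A i)
·-Δ {A} hessA i zero    = sumP-zero (2 ℕ.+ i) λ k _ → ≋0-*ʳ (A i k) (if-no (suc k ℕ.≟ 0) {1P} λ ())
·-Δ {A} hessA i (suc j) =
  ≋-trans (·-sparse-column Δ hessA i j (suc j) λ k k≢j → if-no (suc k ℕ.≟ suc j) (k≢j ∘ ℕₚ.suc-injective))
  (≋-trans (*-congˡ (A i j) (if-yes (suc j ℕ.≟ suc j) refl)) (*-identityʳ (A i j)))

·-first-row : ∀ {A} C → Lower A → (∀ j → A 0 j ≋ I 0 j) → ∀ j → (A · C) 0 j ≋ C 0 j
·-first-row {A} C lowerA row₀ j = ≋-trans
  (sparse-row-· A C 0 0 j (s≤s z≤n) λ k k≢0 → lowerA 0 k (ℕₚ.n≢0⇒n>0 k≢0))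
  (≋-trans (*-congʳ (C 0 j) (row₀ 0)) (*-identityˡ (C 0 j)))

·-⊕ : ∀ A X Y → A · (X ⊕ Y) ≋M (A · X) ⊕ (A · Y)
·-⊕ A X Y i j = ≋-trans (sumP-cong (2 ℕ.+ i) λ k _ → *-distribˡ-+ (A i k) (X k j) (Y k j))
  (sumP-+ (2 ℕ.+ i) (λ k → A i k *P X k j) (λ k → A i k *P Y k j))

·-⊙ : ∀ A c X → A · (c ⊙ X) ≋M c ⊙ (A · X)
·-⊙ A c X i j = ≋-trans
  (sumP-cong (2 ℕ.+ i) λ k _ → solve 3 (λ a c x → a :* (c :* x) := c :* (a :* x)) ≋-refl (A i k) c (X k j))
  (≋-sym (*-distribˡ-sumP (2 ℕ.+ i) c (λ k → A i k *P X k j)))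
  where open PolySolver

I-Lower : Lower I
I-Lower i j i<j = if-no (i ℕ.≟ j) λ { refl → ℕₚ.<-irrefl refl i<j }

Δ-Hessenberg : Hessenberg Δ
Δ-Hessenberg i j 1+i<j = if-no (suc i ℕ.≟ j) λ { refl → ℕₚ.<-irrefl refl 1+i<j }

T₁-Lower : Lower T₁
T₁-Lower i j i<j = if-no (j ℕ.≤? i) (ℕₚ.<⇒≱ i<j)

Δ⊕⊙I-Hessenberg : ∀ z → Hessenberg (Δ ⊕ (z ⊙ I))
Δ⊕⊙I-Hessenberg z i j 1+i<j =
  +-cong (Δ-Hessenberg i j 1+i<j) (≋0-*ʳ z (I-Lower i j (ℕₚ.<-trans (ℕₚ.n<1+n i) 1+i<j)))

·-Δ⊕⊙I : ∀ {A} z → Hessenberg A → A · (Δ ⊕ (z ⊙ I)) ≋M λ i j → shiftRight (A i) j +P z *P A i j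
·-Δ⊕⊙I {A} z hessA i j = ≋-trans (·-⊕ A Δ (z ⊙ I) i j)
  (+-cong (·-Δ hessA i j) (≋-trans (·-⊙ A z I i j) (*-congˡ z (·-I hessA i j))))

row-recurrence-unique : ∀ {F G} (step : ℕ → (ℕ → Poly) → ℕ → Poly) →
                        (∀ i {r s} → (∀ j → r j ≋ s j) → ∀ j → step i r j ≋ step i s j) →
                        (∀ j → F 0 j ≋ G 0 j) →
                        (∀ i j → F (suc i) j ≋ step i (F i) j) →
                        (∀ i j → G (suc i) j ≋ step i (G i) j) →
                        F ≋M G
row-recurrence-unique step step-cong row₀ recF recG zero    j = row₀ j
row-recurrence-unique step step-cong row₀ recF recG (suc i) j = ≋-trans (recF i j)
  (≋-trans (step-cong i (row-recurrence-unique step step-cong row₀ recF recG i) j) (≋-sym (recG i j)))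

column-recurrence-unique : ∀ {X Y} (c : ℕ → Poly) (A : Mat) → Hessenberg X → Hessenberg Y →
                           (∀ i j → X i j ≋ c j *P X i (suc j) +P A i j) →
                           (∀ i j → Y i j ≋ c j *P Y i (suc j) +P A i j) →
                           X ≋M Y
column-recurrence-unique {X} {Y} c A hessX hessY recX recY i j =
  descend (2 ℕ.+ i) j (ℕₚ.m≤n+m (2 ℕ.+ i) j)
  where
  descend : ∀ e j → 2 ℕ.+ i ≤ j ℕ.+ e → X i j ≋ Y i j
  descend zero    j 2+i≤j+0   = ≋-trans (hessX i j 2+i≤j) (≋-sym (hessY i j 2+i≤j))
    where 2+i≤j = ≡.subst (2 ℕ.+ i ≤_) (ℕₚ.+-identityʳ j) 2+i≤j+0
  descend (suc e) j 2+i≤j+1+e = ≋-trans (recX i j) (≋-trans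
    (+-congʳ (*-congˡ (c j) (descend e (suc j) (≡.subst (2 ℕ.+ i ≤_) (ℕₚ.+-suc j e) 2+i≤j+1+e))))
    (≋-sym (recY i j)))

·-row-step : ∀ {A} C → Hessenberg A → ∀ a i j (e : ℕ → Poly) → (∀ k → A (suc i) k ≋ a *P A i k +P e k) →
             (A · C) (suc i) j ≋ a *P (A · C) i j +P sumP (3 ℕ.+ i) (λ k → e k *P C k j)
·-row-step {A} C hessA a i j e rowA = begin
  sumP N (λ k → A (suc i) k *P C k j)
    ≈⟨ sumP-cong N (λ k _ → ≋-trans (*-congʳ (C k j) (rowA k)) (*-distribʳ-+ (C k j) (a *P A i k) (e k))) ⟩
  sumP N (λ k → (a *P A i k) *P C k j +P e k *P C k j)
    ≈⟨ sumP-+ N (λ k → (a *P A i k) *P C k j) (λ k → e k *P C k j) ⟩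
  sumP N (λ k → (a *P A i k) *P C k j) +P sumP N (λ k → e k *P C k j)
    ≈⟨ +-congʳ (sumP-cong N λ k _ → *-assoc a (A i k) (C k j)) ⟩
  sumP N (λ k → a *P (A i k *P C k j)) +P sumP N (λ k → e k *P C k j)
    ≈⟨ +-congʳ (≋-sym (*-distribˡ-sumP N a (λ k → A i k *P C k j))) ⟩
  a *P sumP N (λ k → A i k *P C k j) +P sumP N (λ k → e k *P C k j)
    ≈⟨ +-congʳ (*-congˡ a (≋-sym (·-as-sumP C hessA i j (ℕₚ.n≤1+n (2 ℕ.+ i))))) ⟩
  a *P (A · C) i j +P sumP N (λ k → e k *P C k j)
    ∎
  where
  open SetoidReasoning setoid
  N = 3 ℕ.+ i

-- The binomial matrices

nat-choose-≋0 : ∀ {i j} → i < j → nat (i choose j) ≋ 0P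
nat-choose-≋0 i<j = ≋-trans (≡⇒≋ (cong nat (k>n⇒nCk≡0 i<j))) nat-0

choose-absorption : ∀ n k → suc k ℕ.* (suc n choose suc k) ≡ suc n ℕ.* (n choose k)
choose-absorption zero    zero    = refl
choose-absorption zero    (suc k) = ℕₚ.*-zeroʳ (2 ℕ.+ k)
choose-absorption (suc n) zero    = ≡.trans (ℕₚ.*-identityˡ _) (≡.trans (nC1≡n (2 ℕ.+ n)) (≡.sym (ℕₚ.*-identityʳ _)))
choose-absorption (suc n) (suc k) = begin
  (2 ℕ.+ k) ℕ.* ((2 ℕ.+ n) choose (2 ℕ.+ k))
    ≡⟨ cong ((2 ℕ.+ k) ℕ.*_) (nCk+nC[k+1]≡[n+1]C[k+1] (suc n) (suc k)) ⟨
  (2 ℕ.+ k) ℕ.* (b₁ ℕ.+ b₂)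
    ≡⟨ solve 3 (λ k b₁ b₂ → (con 2 :+ k) :* (b₁ :+ b₂) := b₁ :+ ((con 1 :+ k) :* b₁ :+ (con 2 :+ k) :* b₂)) refl k b₁ b₂ ⟩
  b₁ ℕ.+ (suc k ℕ.* b₁ ℕ.+ (2 ℕ.+ k) ℕ.* b₂)
    ≡⟨ cong (b₁ ℕ.+_) (cong₂ ℕ._+_ (choose-absorption n k) (choose-absorption n (suc k))) ⟩
  b₁ ℕ.+ (suc n ℕ.* (n choose k) ℕ.+ suc n ℕ.* (n choose suc k))
    ≡⟨ cong (b₁ ℕ.+_) (ℕₚ.*-distribˡ-+ (suc n) (n choose k) (n choose suc k)) ⟨
  b₁ ℕ.+ suc n ℕ.* (n choose k ℕ.+ n choose suc k)
    ≡⟨ cong (λ b → b₁ ℕ.+ suc n ℕ.* b) (nCk+nC[k+1]≡[n+1]C[k+1] n k) ⟩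
  b₁ ℕ.+ suc n ℕ.* b₁
    ∎
  where
  open ≡.≡-Reasoning
  open ℕ-Solver.+-*-Solver
  b₁ = suc n choose suc k
  b₂ = suc n choose (2 ℕ.+ k)

B′ : Poly → Mat
B′ x i j = nat (i choose j) *P x ^P (i ∸ j)

B≋B′ : ∀ x → B x ≋M B′ x
B≋B′ x i j with j ℕ.≤? i
... | yes j≤i = if-yes (j ℕ.≤? i) j≤i
... | no  j≰i = ≋-trans (if-no (j ℕ.≤? i) j≰i) (≋-sym (≋0-* (x ^P (i ∸ j)) (nat-choose-≋0 (ℕₚ.≰⇒> j≰i))))

B′-Lower : ∀ x → Lower (B′ x)
B′-Lower x i j i<j = ≋0-* (x ^P (i ∸ j)) (nat-choose-≋0 i<j)

B-Lower : ∀ x → Lower (B x)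
B-Lower x i j i<j = ≋-trans (B≋B′ x i j) (B′-Lower x i j i<j)

B′-cong : ∀ {x y} → x ≋ y → B′ x ≋M B′ y
B′-cong x≋y i j = *-congˡ (nat (i choose j)) (^P-congˡ (i ∸ j) x≋y)

B′-first-row : ∀ x j → B′ x 0 j ≋ I 0 j
B′-first-row x zero    = ≋-refl
B′-first-row x (suc j) = ≋-trans (≋0-* 1P nat-0) (≋-sym (I-Lower 0 (suc j) (s≤s z≤n)))

B′-row-recurrence : ∀ x i j → B′ x (suc i) j ≋ x *P B′ x i j +P shiftRight (B′ x i) j
B′-row-recurrence x i zero    =
  solve 3 (λ c x p → c :* (x :* p) := x :* (c :* p) :+ con 0) ≋-refl (nat 1) x (x ^P i)
  where open PolySolver
B′-row-recurrence x i (suc j) = begin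
  nat (suc i choose suc j) *P p
    ≡⟨ cong (λ c → nat c *P p) (nCk+nC[k+1]≡[n+1]C[k+1] i j) ⟨
  nat (i choose j ℕ.+ i choose suc j) *P p
    ≈⟨ *-congʳ p (nat-+ (i choose j) (i choose suc j)) ⟩
  (nat (i choose j) +P nat (i choose suc j)) *P p
    ≈⟨ solve 3 (λ a b p → (a :+ b) :* p := b :* p :+ a :* p) ≋-refl (nat (i choose j)) (nat (i choose suc j)) p ⟩
  nat (i choose suc j) *P p +P B′ x i j
    ≈⟨ +-congʳ lower-power ⟩
  x *P B′ x i (suc j) +P B′ x i j
    ∎
  where
  open SetoidReasoning setoid
  open PolySolver
  p = x ^P (i ∸ j)
  lower-power : nat (i choose suc j) *P p ≋ x *P B′ x i (suc j)
  lower-power with suc j ℕ.≤? i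
  ... | yes 1+j≤i = ≋-trans (≡⇒≋ (cong (λ e → nat (i choose suc j) *P x ^P e) (ℕₚ.+-∸-assoc 1 1+j≤i)))
    (solve 3 (λ c x q → c :* (x :* q) := x :* (c :* q)) ≋-refl (nat (i choose suc j)) x (x ^P (i ∸ suc j)))
  ... | no  1+j≰i = ≋-trans (≋0-* p (nat-choose-≋0 (ℕₚ.≰⇒> 1+j≰i)))
    (≋-sym (≋0-*ʳ x (B′-Lower x i (suc j) (ℕₚ.≰⇒> 1+j≰i))))

B′-absorption : ∀ x n j → nat (suc j) *P B′ x (suc n) (suc j) ≋ nat (suc n) *P B′ x n j
B′-absorption x n j = begin
  nat (suc j) *P (nat (suc n choose suc j) *P p)       ≈⟨ *-assoc (nat (suc j)) (nat (suc n choose suc j)) p ⟨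
  (nat (suc j) *P nat (suc n choose suc j)) *P p       ≈⟨ *-congʳ p (nat-* (suc j) (suc n choose suc j)) ⟨
  nat (suc j ℕ.* (suc n choose suc j)) *P p            ≡⟨ cong (λ c → nat c *P p) (choose-absorption n j) ⟩
  nat (suc n ℕ.* (n choose j)) *P p                    ≈⟨ *-congʳ p (nat-* (suc n) (n choose j)) ⟩
  (nat (suc n) *P nat (n choose j)) *P p               ≈⟨ *-assoc (nat (suc n)) (nat (n choose j)) p ⟩
  nat (suc n) *P B′ x n j                              ∎
  where
  open SetoidReasoning setoid
  p = x ^P (n ∸ j)

Δ-·-B′ : ∀ x → Δ · B′ x ≋M B′ x · (Δ ⊕ (x ⊙ I))
Δ-·-B′ x i j = ≋-trans (Δ-· (B′ x) i j) (≋-trans (B′-row-recurrence x i j)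
  (≋-trans (+-comm (x *P B′ x i j) (shiftRight (B′ x i) j)) (≋-sym (·-Δ⊕⊙I x (Lower⇒Hessenberg (B′-Lower x)) i j))))

B′-·-B′ : ∀ x y → B′ x · B′ y ≋M B′ (x +P y)
B′-·-B′ x y = row-recurrence-unique step step-cong first-row product-row-recurrence (B′-row-recurrence (x +P y))
  where
  open PolySolver
  step : ℕ → (ℕ → Poly) → ℕ → Poly
  step _ r j = (x +P y) *P r j +P shiftRight r j

  step-cong : ∀ i {r s} → (∀ j → r j ≋ s j) → ∀ j → step i r j ≋ step i s j
  step-cong _ r≋s zero    = +-congʳ (*-congˡ (x +P y) (r≋s zero))
  step-cong _ r≋s (suc j) = +-cong (*-congˡ (x +P y) (r≋s (suc j))) (r≋s j)

  first-row : ∀ j → (B′ x · B′ y) 0 j ≋ B′ (x +P y) 0 j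
  first-row j = ≋-trans (·-first-row (B′ y) (B′-Lower x) (B′-first-row x) j)
    (≋-trans (B′-first-row y j) (≋-sym (B′-first-row (x +P y) j)))

  F = B′ x · B′ y

  product-row-recurrence : ∀ i j → F (suc i) j ≋ step i (F i) j
  product-row-recurrence i j = begin
    F (suc i) j
      ≈⟨ ·-row-step (B′ y) (Lower⇒Hessenberg (B′-Lower x)) x i j (shiftRight (B′ x i)) (B′-row-recurrence x i) ⟩
    x *P F i j +P sumP (3 ℕ.+ i) (λ k → shiftRight (B′ x i) k *P B′ y k j)
      ≈⟨ +-congˡ {x *P F i j} (sumP-suc (2 ℕ.+ i) (λ k → shiftRight (B′ x i) k *P B′ y k j)) ⟩
    x *P F i j +P (B′ x · (λ k → B′ y (suc k))) i j
      ≈⟨ +-congˡ {x *P F i j} (·-congˡ (B′ x) (≋M-sym (Δ-· (B′ y))) i j) ⟩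
    x *P F i j +P (B′ x · (Δ · B′ y)) i j
      ≈⟨ +-congˡ {x *P F i j} (·-congˡ (B′ x) (Δ-·-B′ y) i j) ⟩
    x *P F i j +P (B′ x · (B′ y · (Δ ⊕ (y ⊙ I)))) i j
      ≈⟨ +-congˡ {x *P F i j} (·-assoc-Lower-Hessenberg (Δ ⊕ (y ⊙ I)) (B′-Lower x) (Lower⇒Hessenberg (B′-Lower y)) i j) ⟩
    x *P F i j +P (F · (Δ ⊕ (y ⊙ I))) i j
      ≈⟨ +-congˡ {x *P F i j} (·-Δ⊕⊙I y (Lower⇒Hessenberg (UpperBandwidth-· (B′-Lower x) (B′-Lower y))) i j) ⟩
    x *P F i j +P (shiftRight (F i) j +P y *P F i j)
      ≈⟨ solve 4 (λ x y f s → x :* f :+ (s :+ y :* f) := (x :+ y) :* f :+ s) ≋-refl x y (F i j) (shiftRight (F i) j) ⟩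
    step i (F i) j
      ∎
    where open SetoidReasoning setoid

B-·-B-comm : ∀ x y → B x · B y ≋M B y · B x
B-·-B-comm x y = begin
  B x · B y      ≈⟨ ·-cong (B≋B′ x) (B≋B′ y) ⟩
  B′ x · B′ y    ≈⟨ B′-·-B′ x y ⟩
  B′ (x +P y)    ≈⟨ B′-cong (+-comm x y) ⟩
  B′ (y +P x)    ≈⟨ B′-·-B′ y x ⟨
  B′ y · B′ x    ≈⟨ ·-cong (B≋B′ y) (B≋B′ x) ⟨
  B y · B x      ∎
  where open SetoidReasoning ≋M-setoid

Δ-·-B : ∀ x → Δ · B x ≋M B x · (Δ ⊕ (x ⊙ I))
Δ-·-B x = begin
  Δ · B x                  ≈⟨ ·-congˡ Δ (B≋B′ x) ⟩
  Δ · B′ x                 ≈⟨ Δ-·-B′ x ⟩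
  B′ x · (Δ ⊕ (x ⊙ I))     ≈⟨ ·-congʳ (Δ ⊕ (x ⊙ I)) (B≋B′ x) ⟨
  B x · (Δ ⊕ (x ⊙ I))      ∎
  where open SetoidReasoning ≋M-setoid

𝖳≋B′ : 𝖳 ≋M λ n → B′ (nat n) n
𝖳≋B′ n k with k ℕ.≤? n
... | yes k≤n = ≋-trans (if-yes (k ℕ.≤? n) k≤n)
  (≋-trans (nat-* (n choose k) (n ℕ.^ (n ∸ k))) (*-congˡ (nat (n choose k)) (nat-^ n (n ∸ k))))
... | no  k≰n = ≋-trans (if-no (k ℕ.≤? n) k≰n)
  (≋-sym (≋0-* (nat n ^P (n ∸ k)) (nat-choose-≋0 (ℕₚ.≰⇒> k≰n))))

𝖳-Lower : Lower 𝖳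
𝖳-Lower n k n<k = ≋-trans (𝖳≋B′ n k) (B′-Lower (nat n) n k n<k)

U : Mat
U n = B′ (nat (suc n)) n

U-Lower : Lower U
U-Lower n = B′-Lower (nat (suc n)) n

𝖳·B₁≋U : 𝖳 · B 1P ≋M U
𝖳·B₁≋U n j = begin
  (𝖳 · B 1P) n j              ≈⟨ sumP-cong (2 ℕ.+ n) (λ k _ → *-cong (𝖳≋B′ n k) (B≋B′ 1P k j)) ⟩
  (B′ (nat n) · B′ 1P) n j    ≈⟨ B′-·-B′ (nat n) 1P n j ⟩
  B′ (nat n +P 1P) n j        ≈⟨ B′-cong (≋-trans (+-comm (nat n) 1P) (≋-sym (nat-+ 1 n))) n j ⟩
  U n j                       ∎
  where open SetoidReasoning setoid

Δ·𝖳-column-recurrence : ∀ n j → (Δ · 𝖳) n j ≋ nat (suc j) *P (Δ · 𝖳) n (suc j) +P (U · Δ) n j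
Δ·𝖳-column-recurrence n j = begin
  (Δ · 𝖳) n j                                          ≈⟨ Δ·𝖳≋B′ j ⟩
  B′ z (suc n) j                                       ≈⟨ B′-row-recurrence z n j ⟩
  z *P U n j +P shiftRight (U n) j                     ≈⟨ +-cong (≋-sym (B′-absorption z n j))
                                                                 (≋-sym (·-Δ (Lower⇒Hessenberg U-Lower) n j)) ⟩
  nat (suc j) *P B′ z (suc n) (suc j) +P (U · Δ) n j   ≈⟨ +-congʳ {(U · Δ) n j}
                                                            (*-congˡ (nat (suc j)) (≋-sym (Δ·𝖳≋B′ (suc j)))) ⟩
  nat (suc j) *P (Δ · 𝖳) n (suc j) +P (U · Δ) n j     ∎
  where
  open SetoidReasoning setoid
  z = nat (suc n)
  Δ·𝖳≋B′ : ∀ j → (Δ · 𝖳) n j ≋ B′ z (suc n) j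
  Δ·𝖳≋B′ j = ≋-trans (Δ-· 𝖳 n j) (𝖳≋B′ (suc n) j)

-- The matrix M = D T₁ D⁻¹

δ : ℕ → ℕ → ℕ
δ zero    zero    = 1
δ zero    (suc _) = 0
δ (suc _) zero    = 0
δ (suc a) (suc b) = δ a b

δ-refl : ∀ a → δ a a ≡ 1
δ-refl zero    = refl
δ-refl (suc a) = δ-refl a

δ-≢ : ∀ {a b} → a ≢ b → δ a b ≡ 0
δ-≢ {zero}  {zero}  a≢b = ⊥-elim (a≢b refl)
δ-≢ {zero}  {suc b} _   = refl
δ-≢ {suc a} {zero}  _   = refl
δ-≢ {suc a} {suc b} a≢b = δ-≢ (a≢b ∘ cong suc)

nat-δ : ∀ a b → nat (δ a b) ≋ I a b
nat-δ a b with a ℕ.≟ b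
... | yes refl = ≋-trans (≡⇒≋ (cong nat (δ-refl a))) (≋-sym (if-yes (a ℕ.≟ a) refl))
... | no  a≢b  = ≋-trans (≡⇒≋ (cong nat (δ-≢ a≢b))) (≋-trans nat-0 (≋-sym (if-no (a ℕ.≟ b) a≢b)))

-- factorialRatio i k = i ! / k ! for k ≤ i, and 0 for k > i.
factorialRatio : ℕ → ℕ → ℕ
factorialRatio zero    k = δ 0 k
factorialRatio (suc i) k = suc i ℕ.* factorialRatio i k ℕ.+ δ (suc i) k

factorialRatio-zero : ∀ {i k} → i < k → factorialRatio i k ≡ 0
factorialRatio-zero {zero}  {suc k} _     = refl
factorialRatio-zero {suc i} {k}     1+i<k = cong₂ ℕ._+_
  (≡.trans (cong (suc i ℕ.*_) (factorialRatio-zero (ℕₚ.<-trans (ℕₚ.n<1+n i) 1+i<k))) (ℕₚ.*-zeroʳ (suc i)))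
  (δ-≢ {suc i} {k} λ { refl → ℕₚ.<-irrefl refl 1+i<k })

factorialRatio-diagonal : ∀ i → factorialRatio i i ≡ 1
factorialRatio-diagonal zero    = refl
factorialRatio-diagonal (suc i) = cong₂ ℕ._+_
  (≡.trans (cong (suc i ℕ.*_) (factorialRatio-zero (ℕₚ.n<1+n i))) (ℕₚ.*-zeroʳ (suc i))) (δ-refl i)

factorialRatio-*-! : ∀ {i k} → k ≤ i → factorialRatio i k ℕ.* k ! ≡ i !
factorialRatio-*-! {zero}  {zero} z≤n = refl
factorialRatio-*-! {suc i} {k}    k≤1+i with k ℕ.≟ suc i
... | yes refl = ≡.trans (cong (ℕ._* suc i !) (factorialRatio-diagonal (suc i))) (ℕₚ.*-identityˡ (suc i !))
... | no  k≢1+i = begin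
  (suc i ℕ.* factorialRatio i k ℕ.+ δ (suc i) k) ℕ.* k !
    ≡⟨ cong (λ d → (suc i ℕ.* factorialRatio i k ℕ.+ d) ℕ.* k !) (δ-≢ (k≢1+i ∘ ≡.sym)) ⟩
  (suc i ℕ.* factorialRatio i k ℕ.+ 0) ℕ.* k !
    ≡⟨ solve 3 (λ a r f → (a :* r :+ con 0) :* f := a :* (r :* f)) refl (suc i) (factorialRatio i k) (k !) ⟩
  suc i ℕ.* (factorialRatio i k ℕ.* k !)
    ≡⟨ cong (suc i ℕ.*_) (factorialRatio-*-! (ℕₚ.≤-pred (ℕₚ.≤∧≢⇒< k≤1+i k≢1+i))) ⟩
  suc i ℕ.* i !
    ∎
  where
  open ≡.≡-Reasoning
  open ℕ-Solver.+-*-Solver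

factorialRatio-column : ∀ m j → factorialRatio m j ≡ suc j ℕ.* factorialRatio m (suc j) ℕ.+ δ m j
factorialRatio-column zero    j = cong (ℕ._+ δ 0 j) (≡.sym (ℕₚ.*-zeroʳ (suc j)))
factorialRatio-column (suc m) j = begin
  suc m ℕ.* factorialRatio m j ℕ.+ δ (suc m) j
    ≡⟨ cong (λ r → suc m ℕ.* r ℕ.+ δ (suc m) j) (factorialRatio-column m j) ⟩
  suc m ℕ.* (suc j ℕ.* r ℕ.+ δ m j) ℕ.+ δ (suc m) j
    ≡⟨ solve 5 (λ a b r d e → a :* (b :* r :+ d) :+ e := b :* (a :* r) :+ a :* d :+ e) refl (suc m) (suc j) r (δ m j) (δ (suc m) j) ⟩
  suc j ℕ.* (suc m ℕ.* r) ℕ.+ suc m ℕ.* δ m j ℕ.+ δ (suc m) j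
    ≡⟨ cong (λ d → suc j ℕ.* (suc m ℕ.* r) ℕ.+ d ℕ.+ δ (suc m) j) δ-weight ⟩
  suc j ℕ.* (suc m ℕ.* r) ℕ.+ suc j ℕ.* δ m j ℕ.+ δ (suc m) j
    ≡⟨ cong (ℕ._+ δ (suc m) j) (ℕₚ.*-distribˡ-+ (suc j) (suc m ℕ.* r) (δ m j)) ⟨
  suc j ℕ.* (suc m ℕ.* r ℕ.+ δ m j) ℕ.+ δ (suc m) j
    ∎
  where
  open ≡.≡-Reasoning
  open ℕ-Solver.+-*-Solver
  r = factorialRatio m (suc j)
  δ-weight : suc m ℕ.* δ m j ≡ suc j ℕ.* δ m j
  δ-weight with m ℕ.≟ j
  ... | yes refl = refl
  ... | no  m≢j  = ≡.trans (cong (suc m ℕ.*_) (δ-≢ m≢j))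
    (≡.trans (ℕₚ.*-zeroʳ (suc m)) (≡.sym (≡.trans (cong (suc j ℕ.*_) (δ-≢ m≢j)) (ℕₚ.*-zeroʳ (suc j)))))

M : Mat
M = D · (T₁ · D⁻¹)

M′ : Mat
M′ i k = nat (factorialRatio i k)

M′-Lower : Lower M′
M′-Lower i k i<k = ≋-trans (≡⇒≋ (cong nat (factorialRatio-zero i<k))) nat-0

M≋M′ : M ≋M M′
M≋M′ i k = ≋-trans (D-· (T₁ · D⁻¹) i k) (≋-trans
  (*-congˡ (nat (i !)) (·-sparse-column D⁻¹ (Lower⇒Hessenberg T₁-Lower) i k k λ l l≢k → if-no (l ℕ.≟ k) l≢k))
  (entry (k ℕ.≤? i)))
  where
  instance _ = k ℕₚ.!≢0
  q = + 1 ℚ./ (k !)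
  entry : Dec (k ≤ i) → nat (i !) *P (T₁ i k *P D⁻¹ k k) ≋ M′ i k
  entry (yes k≤i) = begin
    nat (i !) *P (T₁ i k *P D⁻¹ k k)   ≈⟨ *-congˡ (nat (i !)) (*-cong (if-yes (k ℕ.≤? i) k≤i) (if-yes (k ℕ.≟ k) refl)) ⟩
    nat (i !) *P (1P *P const q)       ≈⟨ *-congˡ (nat (i !)) (*-identityˡ (const q)) ⟩
    nat (i !) *P const q               ≈⟨ *-constʳ q (nat (i !)) ⟩
    scale q (nat (i !))                ≈⟨ coeffwise (λ { zero → constant ; (suc _) → refl }) ⟩
    M′ i k                             ∎
    where
    open SetoidReasoning setoid
    constant : q ℚ.* (+ (i !) ℚ./ 1) ≡ + factorialRatio i k ℚ./ 1
    constant = ≡.trans (ℚₚ.*-comm q (+ (i !) ℚ./ 1)) (≡.trans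
      (cong (λ n → (+ n ℚ./ 1) ℚ.* q) (≡.sym (factorialRatio-*-! k≤i))) (/1-*-1/ (factorialRatio i k) (k !)))
  entry (no k≰i) = ≋-trans (≋0-*ʳ (nat (i !)) (≋0-* (D⁻¹ k k) (T₁-Lower i k (ℕₚ.≰⇒> k≰i))))
    (≋-sym (M′-Lower i k (ℕₚ.≰⇒> k≰i)))

M-Lower : Lower M
M-Lower i k i<k = ≋-trans (M≋M′ i k) (M′-Lower i k i<k)

M′-first-row : ∀ j → M′ 0 j ≋ I 0 j
M′-first-row = nat-δ 0

M′-row-recurrence : ∀ i k → M′ (suc i) k ≋ nat (suc i) *P M′ i k +P I (suc i) k
M′-row-recurrence i k = ≋-trans (nat-+ (suc i ℕ.* factorialRatio i k) (δ (suc i) k))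
  (+-cong (nat-* (suc i) (factorialRatio i k)) (nat-δ (suc i) k))

M′-column-recurrence : ∀ i j → M′ i j ≋ nat (suc j) *P M′ i (suc j) +P I i j
M′-column-recurrence i j = ≋-trans (≡⇒≋ (cong nat (factorialRatio-column i j)))
  (≋-trans (nat-+ (suc j ℕ.* factorialRatio i (suc j)) (δ i j))
  (+-cong (nat-* (suc j) (factorialRatio i (suc j))) (nat-δ i j)))

·-M′-column-recurrence : ∀ {A} → Hessenberg A → ∀ i j →
                         (A · M′) i j ≋ nat (suc j) *P (A · M′) i (suc j) +P A i j
·-M′-column-recurrence {A} hessA i j = begin
  sumP N (λ k → A i k *P M′ k j)
    ≈⟨ sumP-cong N (λ k _ → ≋-trans (*-congˡ (A i k) (M′-column-recurrence k j))
         (solve 4 (λ a c m e → a :* (c :* m :+ e) := c :* (a :* m) :+ a :* e) ≋-refl (A i k) c (M′ k (suc j)) (I k j))) ⟩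
  sumP N (λ k → c *P (A i k *P M′ k (suc j)) +P A i k *P I k j)
    ≈⟨ sumP-+ N (λ k → c *P (A i k *P M′ k (suc j))) (λ k → A i k *P I k j) ⟩
  sumP N (λ k → c *P (A i k *P M′ k (suc j))) +P (A · I) i j
    ≈⟨ +-cong (≋-sym (*-distribˡ-sumP N c (λ k → A i k *P M′ k (suc j)))) (·-I hessA i j) ⟩
  c *P (A · M′) i (suc j) +P A i j
    ∎
  where
  open SetoidReasoning setoid
  open PolySolver
  N = 2 ℕ.+ i
  c = nat (suc j)

B′-·-M′-row-recurrence : ∀ x i j → (B′ x · M′) (suc i) j ≋ nat (suc i) *P (B′ x · M′) i j +P B′ x (suc i) j
B′-·-M′-row-recurrence x i j = begin
  sumP (suc N) (λ k → b k *P M′ k j)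
    ≈⟨ sumP-suc N (λ k → b k *P M′ k j) ⟩
  b 0 *P M′ 0 j +P sumP N (λ k → b (suc k) *P M′ (suc k) j)
    ≈⟨ +-congˡ {b 0 *P M′ 0 j} (≋-trans (sumP-cong N λ k _ → shifted-term k) (sumP-+ N _ _)) ⟩
  b 0 *P M′ 0 j +P (sumP N (λ k → c *P (B′ x i k *P M′ k j)) +P sumP N (λ k → b (suc k) *P I (suc k) j))
    ≈⟨ +-congˡ {b 0 *P M′ 0 j} (+-congʳ {sumP N (λ k → b (suc k) *P I (suc k) j)}
         (≋-sym (*-distribˡ-sumP N c (λ k → B′ x i k *P M′ k j)))) ⟩
  b 0 *P M′ 0 j +P (c *P (B′ x · M′) i j +P sumP N (λ k → b (suc k) *P I (suc k) j))
    ≈⟨ solve 3 (λ a g s → a :+ (g :+ s) := g :+ (a :+ s)) ≋-refl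
         (b 0 *P M′ 0 j) (c *P (B′ x · M′) i j) (sumP N (λ k → b (suc k) *P I (suc k) j)) ⟩
  c *P (B′ x · M′) i j +P (b 0 *P M′ 0 j +P sumP N (λ k → b (suc k) *P I (suc k) j))
    ≈⟨ +-congˡ {c *P (B′ x · M′) i j} (≋-trans (+-congʳ {sumP N (λ k → b (suc k) *P I (suc k) j)}
         (*-congˡ (b 0) (M′-first-row j))) (≋-sym (sumP-suc N (λ k → b k *P I k j)))) ⟩
  c *P (B′ x · M′) i j +P (B′ x · I) (suc i) j
    ≈⟨ +-congˡ {c *P (B′ x · M′) i j} (·-I (Lower⇒Hessenberg (B′-Lower x)) (suc i) j) ⟩
  c *P (B′ x · M′) i j +P B′ x (suc i) j
    ∎
  where
  open SetoidReasoning setoid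
  open PolySolver
  N = 2 ℕ.+ i
  c = nat (suc i)
  b = B′ x (suc i)
  shifted-term : ∀ k → b (suc k) *P M′ (suc k) j ≋ c *P (B′ x i k *P M′ k j) +P b (suc k) *P I (suc k) j
  shifted-term k = begin
    b (suc k) *P M′ (suc k) j
      ≈⟨ *-congˡ (b (suc k)) (M′-row-recurrence k j) ⟩
    b (suc k) *P (nat (suc k) *P M′ k j +P I (suc k) j)
      ≈⟨ solve 4 (λ b a m e → b :* (a :* m :+ e) := (a :* b) :* m :+ b :* e) ≋-refl (b (suc k)) (nat (suc k)) (M′ k j) (I (suc k) j) ⟩
    (nat (suc k) *P b (suc k)) *P M′ k j +P b (suc k) *P I (suc k) j
      ≈⟨ +-congʳ {b (suc k) *P I (suc k) j} (≋-trans (*-congʳ (M′ k j) (B′-absorption x i k)) (*-assoc c (B′ x i k) (M′ k j))) ⟩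
    c *P (B′ x i k *P M′ k j) +P b (suc k) *P I (suc k) j
      ∎

M′-·-B′-comm : ∀ x → M′ · B′ x ≋M B′ x · M′
M′-·-B′-comm x = row-recurrence-unique step step-cong first-row
  (λ i j → ≋-trans (·-row-step (B′ x) (Lower⇒Hessenberg M′-Lower) (nat (suc i)) i j (I (suc i)) (M′-row-recurrence i))
                   (+-congˡ {nat (suc i) *P (M′ · B′ x) i j} (I-· (B′ x) (suc i) j)))
  (B′-·-M′-row-recurrence x)
  where
  step : ℕ → (ℕ → Poly) → ℕ → Poly
  step i r j = nat (suc i) *P r j +P B′ x (suc i) j

  step-cong : ∀ i {r s} → (∀ j → r j ≋ s j) → ∀ j → step i r j ≋ step i s j
  step-cong i r≋s j = +-congʳ {B′ x (suc i) j} (*-congˡ (nat (suc i)) (r≋s j))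

  first-row : ∀ j → (M′ · B′ x) 0 j ≋ (B′ x · M′) 0 j
  first-row j = ≋-trans (·-first-row (B′ x) M′-Lower M′-first-row j) (≋-sym
    (≋-trans (·-first-row M′ (B′-Lower x) (B′-first-row x) j) (≋-trans (M′-first-row j) (≋-sym (B′-first-row x j)))))

M-·-B-comm : ∀ x → M · B x ≋M B x · M
M-·-B-comm x = begin
  M · B x      ≈⟨ ·-cong M≋M′ (B≋B′ x) ⟩
  M′ · B′ x    ≈⟨ M′-·-B′-comm x ⟩
  B′ x · M′    ≈⟨ ·-cong (B≋B′ x) M≋M′ ⟨
  B x · M      ∎
  where open SetoidReasoning ≋M-setoid

P : Mat
P = B 1P · (Δ · M)

Δ·M-Hessenberg : Hessenberg (Δ · M)
Δ·M-Hessenberg = UpperBandwidth-· Δ-Hessenberg M-Lower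

𝖳·P≋Δ·𝖳 : 𝖳 · P ≋M Δ · 𝖳
𝖳·P≋Δ·𝖳 = begin
  𝖳 · (B 1P · (Δ · M))   ≈⟨ ·-assoc-Lower 𝖳 (Δ · M) (B-Lower 1P) ⟩
  (𝖳 · B 1P) · (Δ · M)   ≈⟨ ·-congʳ (Δ · M) 𝖳·B₁≋U ⟩
  U · (Δ · M)            ≈⟨ ·-assoc-Lower-Hessenberg M U-Lower Δ-Hessenberg ⟩
  (U · Δ) · M            ≈⟨ ·-congˡ (U · Δ) M≋M′ ⟩
  (U · Δ) · M′           ≈⟨ column-recurrence-unique (nat ∘ suc) (U · Δ)
                              (UpperBandwidth-· (UpperBandwidth-· U-Lower Δ-Hessenberg) M′-Lower)
                              (UpperBandwidth-· Δ-Hessenberg 𝖳-Lower)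
                              (·-M′-column-recurrence (UpperBandwidth-· U-Lower Δ-Hessenberg))
                              Δ·𝖳-column-recurrence ⟩
  Δ · 𝖳                  ∎
  where open SetoidReasoning ≋M-setoid

P·B≋B·B₁·[Δ+xI]·M : ∀ x → P · B x ≋M B x · (B 1P · ((Δ ⊕ (x ⊙ I)) · M))
P·B≋B·B₁·[Δ+xI]·M x = begin
  (B 1P · (Δ · M)) · B x           ≈⟨ ·-assoc-Lower-Hessenberg (B x) (B-Lower 1P) Δ·M-Hessenberg ⟨
  B 1P · ((Δ · M) · B x)           ≈⟨ ·-congˡ (B 1P) (·-assoc-Lower Δ (B x) M-Lower) ⟨
  B 1P · (Δ · (M · B x))           ≈⟨ ·-congˡ (B 1P) (·-congˡ Δ (M-·-B-comm x)) ⟩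
  B 1P · (Δ · (B x · M))           ≈⟨ ·-congˡ (B 1P) (·-assoc-Lower Δ M (B-Lower x)) ⟩
  B 1P · ((Δ · B x) · M)           ≈⟨ ·-congˡ (B 1P) (·-congʳ M (Δ-·-B x)) ⟩
  B 1P · ((B x · Δξ) · M)          ≈⟨ ·-congˡ (B 1P) (·-assoc-Lower-Hessenberg M (B-Lower x) (Δ⊕⊙I-Hessenberg x)) ⟨
  B 1P · (B x · (Δξ · M))          ≈⟨ ·-assoc-Lower-Hessenberg (Δξ · M) (B-Lower 1P) (Lower⇒Hessenberg (B-Lower x)) ⟩
  (B 1P · B x) · (Δξ · M)          ≈⟨ ·-congʳ (Δξ · M) (B-·-B-comm 1P x) ⟩
  (B x · B 1P) · (Δξ · M)          ≈⟨ ·-assoc-Lower (B x) (Δξ · M) (B-Lower 1P) ⟨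
  B x · (B 1P · (Δξ · M))          ∎
  where
  open SetoidReasoning ≋M-setoid
  Δξ = Δ ⊕ (x ⊙ I)

left-inverse-cancel : ∀ A⁻¹ A X → Lower A → A⁻¹ · A ≈M I → A⁻¹ · (A · X) ≋M X
left-inverse-cancel A⁻¹ A X lowerA A⁻¹·A≈I = ≋M-trans (·-assoc-Lower A⁻¹ X lowerA)
  (≋M-trans (·-congʳ {A⁻¹ · A} {I} X λ i j → coeffwise (A⁻¹·A≈I i j)) (I-· X))

proposition5p1 : (𝖳⁻¹ : Mat) → LowerTriangular 𝖳⁻¹ → 𝖳⁻¹ · 𝖳 ≈M I → 𝖳 · 𝖳⁻¹ ≈M I →
    (𝖳⁻¹ · (Δ · 𝖳) ≈M B 1P · (Δ · (D · (T₁ · D⁻¹))))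
    × ((B⁻¹ : Mat) → LowerTriangular B⁻¹ → B⁻¹ · B ξ ≈M I → B ξ · B⁻¹ ≈M I →
    B⁻¹ · ((𝖳⁻¹ · (Δ · 𝖳)) · B ξ) ≈M B 1P · ((Δ ⊕ (ξ ⊙ I)) · (D · (T₁ · D⁻¹))))
proposition5p1 𝖳⁻¹ _ 𝖳⁻¹·𝖳≈I _ = ≋M⇒≈M 𝖳⁻¹·Δ·𝖳≋P , λ B⁻¹ _ B⁻¹·B≈I _ → ≋M⇒≈M (begin
  B⁻¹ · ((𝖳⁻¹ · (Δ · 𝖳)) · B ξ)
    ≈⟨ ·-congˡ B⁻¹ (·-congʳ (B ξ) 𝖳⁻¹·Δ·𝖳≋P) ⟩
  B⁻¹ · (P · B ξ)
    ≈⟨ ·-congˡ B⁻¹ (P·B≋B·B₁·[Δ+xI]·M ξ) ⟩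
  B⁻¹ · (B ξ · (B 1P · ((Δ ⊕ (ξ ⊙ I)) · M)))
    ≈⟨ left-inverse-cancel B⁻¹ (B ξ) _ (B-Lower ξ) B⁻¹·B≈I ⟩
  B 1P · ((Δ ⊕ (ξ ⊙ I)) · M)
    ∎)
  where
  open SetoidReasoning ≋M-setoid
  𝖳⁻¹·Δ·𝖳≋P : 𝖳⁻¹ · (Δ · 𝖳) ≋M P
  𝖳⁻¹·Δ·𝖳≋P = ≋M-trans (·-congˡ 𝖳⁻¹ (≋M-sym 𝖳·P≋Δ·𝖳))
                         (left-inverse-cancel 𝖳⁻¹ 𝖳 P 𝖳-Lower 𝖳⁻¹·𝖳≈I)
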